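{- Let $\chi$ be a partial $(\Delta+1)$-edge coloring of a graph $G$, let $\mathcal U$ be a separable collection of u-components with respect to $\chi$, and let $P$ be a maximal alternating path in $\chi$. Then flipping the colors of $P$ damages at most $2$ u-components in $\mathcal U$.
   Context: $G=(V,E)$ is a simple graph of maximum degree $\Delta$; a partial $(\Delta+1)$-edge coloring is $\chi:E\to[\Delta+1]\cup\{\bot\}$ with adjacent colored edges receiving distinct colors ($\chi(e)=\bot$ means uncolored). $\mathsf{miss}_\chi(u)$ is the set of colors in $[\Delta+1]$ not used on edges at $u$. A path $e_1,\dots,e_k$ is $\{\alpha,\beta\}$-alternating if its edges are colored alternately $\alpha,\beta$; it is maximal if at each endpoint one of $\alpha,\beta$ is missing; flipping it swaps $\alpha$ and $\beta$ on its edges. A u-fan is a tuple $(u,v,w,\alpha,\beta)$ with $u,v,w$ distinct, $\alpha\ne\beta$, $(u,v),(u,w)$ uncolored edges, $\alpha\in\mathsf{miss}_\chi(u)$, $\beta\in\mathsf{miss}_\chi(v)\cap\mathsf{miss}_\chi(w)$; it assigns $c(u)=\alpha$, $c(v)=c(w)=\beta$. A u-edge is a tuple $(u,v,\alpha)$ with $(u,v)$ uncolored and $\alpha\in\mathsf{miss}_\chi(u)$; it assigns $c(u)=\alpha$, $c(v)=\bot$. A u-component is a u-fan or u-edge. A collection $\mathcal U$ of u-components is separable if its u-components are pairwise edge-disjoint and, for each vertex $x$, the colors $c_{\mathbf g}(x)$ over $\mathbf g\in\mathcal U$ containing $x$ are pairwise distinct (as a multiset). After modifying $\chi$, a u-component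 of $\mathcal U$ is damaged if it is no longer a u-component with respect to the new coloring. -}

module Defs where

open import Data.Nat using (ℕ; zero; suc; _≤_)
open import Data.Fin using (Fin; _≟_)
open import Data.Bool using (Bool; true; false; if_then_else_; _∧_; _∨_)
open import Data.Maybe using (Maybe; just; nothing)
import Data.Maybe as Maybe
open import Data.List using (List; []; _∷_; length; filterᵇ; lookup)
open import Data.List.Relation.Unary.Unique.Propositional using (Unique)
open import Data.Product using (Σ; ∃; _×_; _,_)
open import Data.Sum using (_⊎_)
open import Data.Unit using (⊤)
open import Data.Empty using (⊥)
open import Relation.Nullary using (¬_; ⌊_⌋)
open import Relation.Binary.PropositionalEquality using (_≡_; _≢_)
open import Data.List using (allFin)

record SimpleGraph (n : ℕ) : Set where
  field
    adj    : Fin n → Fin n → Bool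
    sym    : ∀ u v → adj u v ≡ adj v u
    irrefl : ∀ u → adj u u ≡ false
open SimpleGraph public

degree : ∀ {n} → SimpleGraph n → Fin n → ℕ
degree {n} G u = length (filterᵇ (adj G u) (allFin n))

MaxDegree : ∀ {n} → SimpleGraph n → ℕ → Set
MaxDegree G Δ = (∀ u → degree G u ≤ Δ) × (∃ λ u → degree G u ≡ Δ)

-- Partial (Δ+1)-edge colourings: colours are Fin (suc Δ) = [Δ+1],
-- `nothing` is ⊥ (uncoloured).  A colouring is given as a symmetric
-- function on ordered pairs that is `nothing` on non-edges.

Colour : ℕ → Set
Colour Δ = Fin (suc Δ)

Colouring : ℕ → ℕ → Set
Colouring n Δ = Fin n → Fin n → Maybe (Colour Δ)

record IsPartialColouring {n Δ} (G : SimpleGraph n) (χ : Colouring n Δ) : Set where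
  field
    symm     : ∀ u v → χ u v ≡ χ v u
    nonEdge  : ∀ u v → adj G u v ≡ false → χ u v ≡ nothing
    proper   : ∀ u v w (c : Colour Δ) → v ≢ w →
               χ u v ≡ just c → χ u w ≢ just c

Miss : ∀ {n Δ} → Colouring n Δ → Fin n → Colour Δ → Set
Miss χ u α = ∀ v → χ u v ≢ just α

Uncoloured : ∀ {n Δ} → SimpleGraph n → Colouring n Δ → Fin n → Fin n → Set
Uncoloured G χ u v = (adj G u v ≡ true) × (χ u v ≡ nothing)

data UComp (n Δ : ℕ) : Set where
  ufan  : (u v w : Fin n) (α β : Colour Δ) → UComp n Δ
  uedge : (u v : Fin n) (α : Colour Δ) → UComp n Δ

IsUComp : ∀ {n Δ} → SimpleGraph n → Colouring n Δ → UComp n Δ → Set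
IsUComp G χ (ufan u v w α β) =
  (u ≢ v) × (u ≢ w) × (v ≢ w) × (α ≢ β) ×
  Uncoloured G χ u v × Uncoloured G χ u w ×
  Miss χ u α × Miss χ v β × Miss χ w β
IsUComp G χ (uedge u v α) = Uncoloured G χ u v × Miss χ u α

-- x ∈ g and c_g(x) = c   (c = nothing stands for ⊥)
Assigns : ∀ {n Δ} → UComp n Δ → Fin n → Maybe (Colour Δ) → Set
Assigns (ufan u v w α β) x c =
  (x ≡ u × c ≡ just α) ⊎ (x ≡ v × c ≡ just β) ⊎ (x ≡ w × c ≡ just β)
Assigns (uedge u v α) x c = (x ≡ u × c ≡ just α) ⊎ (x ≡ v × c ≡ nothing)

SameEdge : ∀ {n} → Fin n → Fin n → Fin n → Fin n → Set
SameEdge x y a b = (a ≡ x × b ≡ y) ⊎ (a ≡ y × b ≡ x)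

EdgeOf : ∀ {n Δ} → UComp n Δ → Fin n → Fin n → Set
EdgeOf (ufan u v w α β) a b = SameEdge u v a b ⊎ SameEdge u w a b
EdgeOf (uedge u v α) a b = SameEdge u v a b

-- A separable collection of u-components w.r.t. χ (given as a list,
-- i.e. a multiset indexed by positions).
record Separable {n Δ} (G : SimpleGraph n) (χ : Colouring n Δ)
                 (𝒰 : List (UComp n Δ)) : Set where
  field
    components   : ∀ i → IsUComp G χ (lookup 𝒰 i)
    edgeDisjoint : ∀ i j → i ≢ j → ∀ a b →
                   EdgeOf (lookup 𝒰 i) a b → ¬ EdgeOf (lookup 𝒰 j) a b
    distinctCols : ∀ i j → i ≢ j → ∀ x c c′ →
                   Assigns (lookup 𝒰 i) x c → Assigns (lookup 𝒰 j) x c′ → c ≢ c′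

Alternating : ∀ {n Δ} → Colouring n Δ → Colour Δ → Colour Δ → List (Fin n) → Set
Alternating χ α β []           = ⊤
Alternating χ α β (x ∷ [])     = ⊤
Alternating χ α β (x ∷ y ∷ xs) = (χ x y ≡ just α) × Alternating χ β α (y ∷ xs)

lastOf : ∀ {n} → Fin n → List (Fin n) → Fin n
lastOf x []       = x
lastOf x (y ∷ ys) = lastOf y ys

record MaximalAltPath {n Δ} (χ : Colouring n Δ) (α β : Colour Δ)
                      (x : Fin n) (xs : List (Fin n)) : Set where
  field
    distinctCols : α ≢ β
    nonTrivial   : xs ≢ []
    isPath       : Unique (x ∷ xs)
    alternating  : Alternating χ α β (x ∷ xs) ⊎ Alternating χ β α (x ∷ xs)
    maxStart     : Miss χ x α ⊎ Miss χ x β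
    maxEnd       : Miss χ (lastOf x xs) α ⊎ Miss χ (lastOf x xs) β

onPath : ∀ {n} → List (Fin n) → Fin n → Fin n → Bool
onPath []           a b = false
onPath (x ∷ [])     a b = false
onPath (x ∷ y ∷ ps) a b =
  ((⌊ x ≟ a ⌋ ∧ ⌊ y ≟ b ⌋) ∨ (⌊ x ≟ b ⌋ ∧ ⌊ y ≟ a ⌋)) ∨ onPath (y ∷ ps) a b

swapCol : ∀ {Δ} → Colour Δ → Colour Δ → Colour Δ → Colour Δ
swapCol α β c = if ⌊ c ≟ α ⌋ then β else (if ⌊ c ≟ β ⌋ then α else c)

flipPath : ∀ {n Δ} → Colouring n Δ → Colour Δ → Colour Δ → List (Fin n) →
           Colouring n Δ
flipPath χ α β ps u v =
  if onPath ps u v then Maybe.map (swapCol α β) (χ u v) else χ u v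

Damaged : ∀ {n Δ} → SimpleGraph n → Colouring n Δ → UComp n Δ → Set
Damaged G χ′ g = ¬ IsUComp G χ′ g

AtMostTwoDamaged : ∀ {n Δ} → SimpleGraph n → Colouring n Δ → List (UComp n Δ) → Set
AtMostTwoDamaged G χ′ 𝒰 =
  ∀ i j k → i ≢ j → i ≢ k → j ≢ k →
  ¬ (Damaged G χ′ (lookup 𝒰 i) × Damaged G χ′ (lookup 𝒰 j) × Damaged G χ′ (lookup 𝒰 k))

{-# OPTIONS --safe #-}
-- Flipping an alternating path P leaves uncoloured edges uncoloured, and it
-- can take a colour away from miss(y) only if y lies on an edge of P and the
-- colour is α or β; an interior vertex of P misses neither. Hence a damaged
-- u-component has a vertex y at an endpoint of P whose assigned colour is the
-- new colour of a path edge at y. That new colour is forced by y missing it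
-- beforehand, so two components damaged at the same endpoint would assign y
-- the same colour, against separability. P has two endpoints, so at most two
-- components are damaged.
module Submission where

open import Defs hiding (sym)
open import Data.Nat using (ℕ)
open import Data.Fin using (Fin; _≟_)
open import Data.List using (List; []; _∷_; lookup)
open import Data.Bool using (T; true; false)
open import Data.Bool.Properties using (T-∨; T-∧)
open import Data.Maybe using (just; nothing)
import Data.Maybe as Maybe
open import Data.Maybe.Properties using (just-injective)
open import Data.Product using (_×_; _,_)
import Data.Product as Product
open import Data.Sum using (_⊎_; inj₁; inj₂)
import Data.Sum as Sum
open import Data.Empty using (⊥-elim)
open import Function using (_∘_; id; case_of_)
open import Function.Bundles using (Equivalence)
open import Relation.Nullary using (¬_; yes; no)
open import Relation.Nullary.Decidable using (toWitness; T?; toSum)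
open import Relation.Binary.PropositionalEquality using (_≡_; _≢_; refl; sym; trans; cong; subst)

pigeonhole : ∀ {A : Set} {p q a b c : A} →
             a ≡ p ⊎ a ≡ q → b ≡ p ⊎ b ≡ q → c ≡ p ⊎ c ≡ q →
             a ≡ b ⊎ a ≡ c ⊎ b ≡ c
pigeonhole (inj₁ refl) (inj₁ refl) _           = inj₁ refl
pigeonhole (inj₂ refl) (inj₂ refl) _           = inj₁ refl
pigeonhole (inj₁ refl) (inj₂ refl) (inj₁ refl) = inj₂ (inj₁ refl)
pigeonhole (inj₁ refl) (inj₂ refl) (inj₂ refl) = inj₂ (inj₂ refl)
pigeonhole (inj₂ refl) (inj₁ refl) (inj₁ refl) = inj₂ (inj₂ refl)
pigeonhole (inj₂ refl) (inj₁ refl) (inj₂ refl) = inj₂ (inj₁ refl)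

swapCol-α : ∀ {Δ} (α β : Colour Δ) → swapCol α β α ≡ β
swapCol-α α β with α ≟ α
... | yes _   = refl
... | no α≢α = ⊥-elim (α≢α refl)

swapCol-β : ∀ {Δ} {α β : Colour Δ} → α ≢ β → swapCol α β β ≡ α
swapCol-β {α = α} {β} α≢β with β ≟ α
... | yes β≡α = ⊥-elim (α≢β (sym β≡α))
... | no _ with β ≟ β
...   | yes _   = refl
...   | no β≢β = ⊥-elim (β≢β refl)

onPath-∷ : ∀ {n} (p q : Fin n) ps {a b} → T (onPath (p ∷ q ∷ ps) a b) →
           SameEdge a b p q ⊎ T (onPath (q ∷ ps) a b)
onPath-∷ p q ps {a} {b} on with Equivalence.to T-∨ on
... | inj₂ later = inj₂ later
... | inj₁ first with Equivalence.to T-∨ first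
...   | inj₁ pq = inj₁ (inj₁ (Product.map (toWitness {a? = p ≟ a}) (toWitness {a? = q ≟ b})
                                           (Equivalence.to T-∧ pq)))
...   | inj₂ qp = inj₁ (inj₂ (Product.map (toWitness {a? = p ≟ b}) (toWitness {a? = q ≟ a})
                                           (Equivalence.to T-∧ qp)))

onPath-tail : ∀ {n} (p q : Fin n) ps {u v} → T (onPath (p ∷ q ∷ ps) u v) →
              u ≢ p → u ≢ q → T (onPath (q ∷ ps) u v)
onPath-tail p q ps on u≢p u≢q = Sum.[ first-edge , id ] (onPath-∷ p q ps on)
  where
  first-edge : SameEdge _ _ p q → T (onPath (q ∷ ps) _ _)
  first-edge (inj₁ (p≡u , _)) = ⊥-elim (u≢p (sym p≡u))
  first-edge (inj₂ (_ , q≡u)) = ⊥-elim (u≢q (sym q≡u))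

module _ {n Δ} {χ : Colouring n Δ} (χ-sym : ∀ u v → χ u v ≡ χ v u) where

  SameEdge-colour : ∀ {u v p q c} → SameEdge u v p q → χ p q ≡ c → χ u v ≡ c
  SameEdge-colour (inj₁ (refl , refl)) χpq = χpq
  SameEdge-colour (inj₂ (refl , refl)) χpq = trans (χ-sym _ _) χpq

  Alternating-colour : ∀ {a b} ps {u v} → Alternating χ a b ps → T (onPath ps u v) →
                       χ u v ≡ just a ⊎ χ u v ≡ just b
  Alternating-colour [] _ ()
  Alternating-colour (p ∷ []) _ ()
  Alternating-colour (p ∷ q ∷ ps) (χpq , alt) on =
    Sum.[ (λ uv≡pq → inj₁ (SameEdge-colour uv≡pq χpq)) , Sum.swap ∘ Alternating-colour (q ∷ ps) alt ]
      (onPath-∷ p q ps on)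

  Alternating-second-sees-both : ∀ {a b p q r ps} → Alternating χ a b (p ∷ q ∷ r ∷ ps) →
                                 ¬ Miss χ q a × ¬ Miss χ q b
  Alternating-second-sees-both {p = p} {q} {r} (χpq , χqr , _) =
    (λ miss → miss p (trans (χ-sym q p) χpq)) , (λ miss → miss r χqr)

  Alternating-interior-sees-both : ∀ {a b} p ps {u v} → Alternating χ a b (p ∷ ps) →
                                   T (onPath (p ∷ ps) u v) → u ≢ p → u ≢ lastOf p ps →
                                   ¬ Miss χ u a × ¬ Miss χ u b
  Alternating-interior-sees-both p [] _ ()
  Alternating-interior-sees-both p (q ∷ []) _ on u≢p u≢q = ⊥-elim (onPath-tail p q [] on u≢p u≢q)
  Alternating-interior-sees-both {a} {b} p (q ∷ r ∷ ps) {u} alt@(_ , alt′) on u≢p u≢last =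
    Sum.[ (λ q≡u → subst (λ s → ¬ Miss χ s a × ¬ Miss χ s b) q≡u
                           (Alternating-second-sees-both alt))
        , (λ q≢u → Product.swap
                     (Alternating-interior-sees-both q (r ∷ ps) alt′
                       (onPath-tail p q (r ∷ ps) on u≢p (q≢u ∘ sym)) (q≢u ∘ sym) u≢last)) ]
      (toSum (q ≟ u))

module _ {n Δ} (χ : Colouring n Δ) (α β : Colour Δ) (ps : List (Fin n)) where

  flipPath-offPath : ∀ {u v} → ¬ T (onPath ps u v) → flipPath χ α β ps u v ≡ χ u v
  flipPath-offPath {u} {v} off with onPath ps u v
  ... | true  = ⊥-elim (off _)
  ... | false = refl

  flipPath-onPath : ∀ {u v d} → T (onPath ps u v) → χ u v ≡ just d →
                    flipPath χ α β ps u v ≡ just (swapCol α β d)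
  flipPath-onPath {u} {v} on χd with onPath ps u v
  ... | true  = cong (Maybe.map (swapCol α β)) χd
  ... | false = ⊥-elim on

  flipPath-uncoloured : ∀ {u v} → χ u v ≡ nothing → flipPath χ α β ps u v ≡ nothing
  flipPath-uncoloured {u} {v} χuv with onPath ps u v
  ... | true  = cong (Maybe.map (swapCol α β)) χuv
  ... | false = χuv

  Miss-flipPath : ∀ {y c} → Miss χ y c →
                  (∀ v → T (onPath ps y v) → flipPath χ α β ps y v ≢ just c) →
                  Miss (flipPath χ α β ps) y c
  Miss-flipPath {y} miss fresh v χ′yv with T? (onPath ps y v)
  ... | yes on  = fresh v on χ′yv
  ... | no off = miss v (trans (sym (flipPath-offPath off)) χ′yv)

  flipPath-recolours : ∀ {u v c} → α ≢ β → T (onPath ps u v) →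
                       χ u v ≡ just α ⊎ χ u v ≡ just β →
                       flipPath χ α β ps u v ≡ just c →
                       (χ u v ≡ just α × c ≡ β) ⊎ (χ u v ≡ just β × c ≡ α)
  flipPath-recolours α≢β on (inj₁ χα) χ′c =
    inj₁ (χα , trans (just-injective (trans (sym χ′c) (flipPath-onPath on χα))) (swapCol-α α β))
  flipPath-recolours α≢β on (inj₂ χβ) χ′c =
    inj₂ (χβ , trans (just-injective (trans (sym χ′c) (flipPath-onPath on χβ))) (swapCol-β α≢β))

Assigns⇒Miss : ∀ {n Δ} {G : SimpleGraph n} {χ : Colouring n Δ} {y c} g →
               IsUComp G χ g → Assigns g y (just c) → Miss χ y c
Assigns⇒Miss (ufan _ _ _ _ _) (_ , _ , _ , _ , _ , _ , miss-u , _ , _) (inj₁ (refl , refl))         = miss-u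
Assigns⇒Miss (ufan _ _ _ _ _) (_ , _ , _ , _ , _ , _ , _ , miss-v , _) (inj₂ (inj₁ (refl , refl))) = miss-v
Assigns⇒Miss (ufan _ _ _ _ _) (_ , _ , _ , _ , _ , _ , _ , _ , miss-w) (inj₂ (inj₂ (refl , refl))) = miss-w
Assigns⇒Miss (uedge _ _ _) (_ , miss-u) (inj₁ (refl , refl)) = miss-u
Assigns⇒Miss (uedge _ _ _) _ (inj₂ (_ , ()))

module FlipOfAlternatingPath {n Δ} (G : SimpleGraph n) {χ : Colouring n Δ}
                             (pc : IsPartialColouring G χ) {α β : Colour Δ}
                             {x : Fin n} {xs : List (Fin n)}
                             (P : MaximalAltPath χ α β x xs) where
  open IsPartialColouring pc using (symm)
  open MaximalAltPath P using (alternating) renaming (distinctCols to α≢β)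

  χ′ : Colouring n Δ
  χ′ = flipPath χ α β (x ∷ xs)

  pathEdge-colour : ∀ {u v} → T (onPath (x ∷ xs) u v) → χ u v ≡ just α ⊎ χ u v ≡ just β
  pathEdge-colour on with alternating
  ... | inj₁ alt = Alternating-colour symm (x ∷ xs) alt on
  ... | inj₂ alt = Sum.swap (Alternating-colour symm (x ∷ xs) alt on)

  interior-sees-α-β : ∀ {u v} → T (onPath (x ∷ xs) u v) → u ≢ x → u ≢ lastOf x xs →
                      ¬ Miss χ u α × ¬ Miss χ u β
  interior-sees-α-β on u≢x u≢last with alternating
  ... | inj₁ alt = Alternating-interior-sees-both symm x xs alt on u≢x u≢last
  ... | inj₂ alt = Product.swap (Alternating-interior-sees-both symm x xs alt on u≢x u≢last)

  recolouring : ∀ {u v c} → T (onPath (x ∷ xs) u v) → χ′ u v ≡ just c →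
                (χ u v ≡ just α × c ≡ β) ⊎ (χ u v ≡ just β × c ≡ α)
  recolouring on = flipPath-recolours χ α β (x ∷ xs) α≢β on (pathEdge-colour on)

  recolouring-unique : ∀ {y v v′ c c′} → Miss χ y c′ →
                       T (onPath (x ∷ xs) y v) → χ′ y v ≡ just c →
                       T (onPath (x ∷ xs) y v′) → χ′ y v′ ≡ just c′ → c ≡ c′
  recolouring-unique {v = v} miss on χ′c on′ χ′c′
    with recolouring on χ′c | recolouring on′ χ′c′
  ... | inj₁ (_ , refl)  | inj₁ (_ , refl)  = refl
  ... | inj₂ (_ , refl)  | inj₂ (_ , refl)  = refl
  ... | inj₁ (χα , _)    | inj₂ (_ , refl)  = ⊥-elim (miss v χα)
  ... | inj₂ (χβ , _)    | inj₁ (_ , refl)  = ⊥-elim (miss v χβ)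

  record FlipConflict (g : UComp n Δ) : Set where
    field
      vertex     : Fin n
      colour     : Colour Δ
      assigned   : Assigns g vertex (just colour)
      neighbour  : Fin n
      pathEdge   : T (onPath (x ∷ xs) vertex neighbour)
      recoloured : χ′ vertex neighbour ≡ just colour
  open FlipConflict

  assigned-Miss-flip : ∀ {g y c} → IsUComp G χ g → ¬ FlipConflict g →
                       Assigns g y (just c) → Miss χ′ y c
  assigned-Miss-flip {g} {y} {c} ok no-conflict a =
    Miss-flipPath χ α β (x ∷ xs) (Assigns⇒Miss g ok a) λ v on χ′c →
      no-conflict (record { vertex = y ; colour = c ; assigned = a
                          ; neighbour = v ; pathEdge = on ; recoloured = χ′c })

  IsUComp-flip : ∀ g → IsUComp G χ g → ¬ FlipConflict g → IsUComp G χ′ g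
  IsUComp-flip (ufan u v w a b) ok@(u≢v , u≢w , v≢w , a≢b , (uv , χuv) , (uw , χuw) , _) no-conflict =
    u≢v , u≢w , v≢w , a≢b ,
    (uv , flipPath-uncoloured χ α β (x ∷ xs) χuv) , (uw , flipPath-uncoloured χ α β (x ∷ xs) χuw) ,
    survives (inj₁ (refl , refl)) , survives (inj₂ (inj₁ (refl , refl))) ,
    survives (inj₂ (inj₂ (refl , refl)))
    where
    survives : ∀ {y c} → Assigns (ufan u v w a b) y (just c) → Miss χ′ y c
    survives = assigned-Miss-flip ok no-conflict
  IsUComp-flip (uedge u v a) ok@((uv , χuv) , _) no-conflict =
    (uv , flipPath-uncoloured χ α β (x ∷ xs) χuv) ,
    assigned-Miss-flip ok no-conflict (inj₁ (refl , refl))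

  FlipConflict-atEndpoint : ∀ {g} → IsUComp G χ g → (f : FlipConflict g) →
                            vertex f ≡ x ⊎ vertex f ≡ lastOf x xs
  FlipConflict-atEndpoint {g} ok f with vertex f ≟ x | vertex f ≟ lastOf x xs
  ... | yes y≡x | _          = inj₁ y≡x
  ... | no _    | yes y≡last = inj₂ y≡last
  ... | no y≢x  | no y≢last with interior-sees-α-β (pathEdge f) y≢x y≢last
                                | recolouring (pathEdge f) (recoloured f)
  ...   | (sees-α , _) | inj₂ (_ , refl) = ⊥-elim (sees-α (Assigns⇒Miss g ok (assigned f)))
  ...   | (_ , sees-β) | inj₁ (_ , refl) = ⊥-elim (sees-β (Assigns⇒Miss g ok (assigned f)))

  FlipConflicts-apart : ∀ {𝒰} → Separable G χ 𝒰 → ∀ {i j} → i ≢ j →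
                        (fᵢ : FlipConflict (lookup 𝒰 i)) (fⱼ : FlipConflict (lookup 𝒰 j)) →
                        vertex fᵢ ≢ vertex fⱼ
  FlipConflicts-apart sep {i} {j} i≢j fᵢ fⱼ refl =
    distinctCols i j i≢j (vertex fᵢ) _ _ (assigned fᵢ) (assigned fⱼ)
      (cong just (recolouring-unique (Assigns⇒Miss _ (components j) (assigned fⱼ))
                    (pathEdge fᵢ) (recoloured fᵢ) (pathEdge fⱼ) (recoloured fⱼ)))
    where open Separable sep

lemma5p4 : ∀ {n Δ : ℕ} (G : SimpleGraph n) → MaxDegree G Δ →
           (χ : Colouring n Δ) → IsPartialColouring G χ →
           (𝒰 : List (UComp n Δ)) → Separable G χ 𝒰 →
           (α β : Colour Δ) (x : Fin n) (xs : List (Fin n)) →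
           MaximalAltPath χ α β x xs →
           AtMostTwoDamaged G (flipPath χ α β (x ∷ xs)) 𝒰
lemma5p4 G _ χ pc 𝒰 sep α β x xs P i j k i≢j i≢k j≢k (dᵢ , dⱼ , dₖ) =
  dᵢ (intact i λ fᵢ → dⱼ (intact j λ fⱼ → dₖ (intact k λ fₖ →
    case pigeonhole (atEndpoint i fᵢ) (atEndpoint j fⱼ) (atEndpoint k fₖ) of λ where
      (inj₁ same)        → FlipConflicts-apart sep i≢j fᵢ fⱼ same
      (inj₂ (inj₁ same)) → FlipConflicts-apart sep i≢k fᵢ fₖ same
      (inj₂ (inj₂ same)) → FlipConflicts-apart sep j≢k fⱼ fₖ same)))
  where
  open FlipOfAlternatingPath G pc P
  open Separable sep using (components)
  intact : ∀ i → ¬ FlipConflict (lookup 𝒰 i) → IsUComp G χ′ (lookup 𝒰 i)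
  intact i = IsUComp-flip (lookup 𝒰 i) (components i)

  atEndpoint : ∀ i (f : FlipConflict (lookup 𝒰 i)) →
               FlipConflict.vertex f ≡ x ⊎ FlipConflict.vertex f ≡ lastOf x xs
  atEndpoint i = FlipConflict-atEndpoint (components i)
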